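{- Let $F$ be a zippable set functor that preserves intersections, equipped with a subnatural encoding $\flat_X\colon FX\to\mathcal{B}(A\times X)$ for which $F$ has a refinement interface. Then for every finite set $X$ we have $\tau^F_X=\tau^{\mathcal{B}(A\times-)}_X\circ\flat_X$; in particular, for every $F$-coalgebra $c\colon X\to FX$ on a finite set $X$, its canonical graph $\tau^F_X\circ c\colon X\to\mathcal{P}X$ coincides with the canonical graph $\tau^{\mathcal{B}(A\times-)}_X\circ\flat_X\circ c$ of its encoding.
   Context: $\mathcal{B}$ is the bag functor ($\mathcal{B}X$ = finitely supported maps $X\to\mathbb{N}$; $\mathcal{B}f(b)(y)=\sum_{f(x)=y}b(x)$); $\mathcal{P}$ is the powerset. $1=\{*\}$, $!$ the unique map to $1$, $3=\{0,1,2\}$. For $S\subseteq X$, $\mathrm{fil}_S\colon\mathcal{B}(A\times X)\to\mathcal{B}(A)$, $\mathrm{fil}_S(b)(a)=\sum_{x\in S}b(a,x)$. An encoding of $F$ is a label set $A$ with maps $\flat_X\colon FX\to\mathcal{B}(A\times X)$ such that $\langle F!,\flat_X\rangle\colon FX\to F1\times\mathcal{B}(A\times X)$ is injective for each $X$; it is subnatural if $\mathcal{B}(A\times m)\circ\flat_X=\flat_Y\circ Fm$ for every injective $m$. $F$ preserves intersections if it maps pullbacks of pairs of injective maps to pullbacks. $F$ is zippable if $\langle F(A'+!),F(!+B')\rangle\colon F(A'+B')\to F(A'+1)\times F(1+B')$ is injective for all sets $A',B'$. For $S\subseteq C\subseteq X$, $\chi^C_S\colon X\to3$ maps $S$ to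 $2$, $C\setminus S$ to $1$, $X\setminus C$ to $0$. A refinement interface (for $A,\flat$) is a set $W$ with $\mathrm{init}\colon F1\times\mathcal{B}A\to W$, $\mathrm{update}\colon\mathcal{B}A\times W\to W\times F3\times W$ such that for each set $X$ there is $w\colon\mathcal{P}X\to(FX\to W)$ with $\mathrm{init}\circ\langle F!,\mathrm{fil}_X\circ\flat_X\rangle=w(X)$ and $\mathrm{update}\circ\langle\mathrm{fil}_S\circ\flat_X,w(C)\rangle=\langle w(S),F\chi^C_S,w(C\setminus S)\rangle$ for all $S\subseteq C\subseteq X$. For a set functor $G$ and $t\in GX$, $\tau^G_X(t)=\{x\in X\mid t\notin Gi[G(X\setminus\{x\})]\}$ with $i\colon X\setminus\{x\}\hookrightarrow X$ the inclusion. -}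

module Defs where

open import Data.Bool using (Bool; true; false; if_then_else_; _∧_; not)
open import Data.Unit using (⊤; tt)
open import Data.Fin using (Fin)
open import Data.Nat using (ℕ)
open import Data.Product using (Σ; _×_; _,_; proj₁; proj₂; map₂)
open import Data.Sum using (_⊎_; inj₁; inj₂)
import Data.Sum as Sum
open import Data.List using (List; []; _∷_; map)
open import Data.List.Relation.Binary.Permutation.Propositional using (_↭_)
open import Function using (id; _∘_; const)
open import Function.Definitions using (Injective)
open import Relation.Binary.PropositionalEquality using (_≡_; _≢_)
open import Relation.Nullary using (¬_)

record SetFunctor : Set₁ where
  field
    F        : Set → Set
    fmap     : ∀ {X Y : Set} → (X → Y) → F X → F Y
    fmap-id  : ∀ {X : Set} (t : F X) → fmap id t ≡ t
    fmap-∘   : ∀ {X Y Z : Set} (f : X → Y) (g : Y → Z) (t : F X) →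
               fmap (g ∘ f) t ≡ fmap g (fmap f t)
    fmap-cong : ∀ {X Y : Set} {f g : X → Y} → (∀ x → f x ≡ g x) →
                ∀ (t : F X) → fmap f t ≡ fmap g t

-- Bags (finite multisets) B X are represented as lists up to permutation (_↭_).
-- B(A × X) and its functor action B(A × f):
BA : Set → Set → Set
BA A X = List (A × X)

BAmap : ∀ {A X Y : Set} → (X → Y) → BA A X → BA A Y
BAmap f = map (map₂ f)

Sub : Set → Set
Sub X = X → Bool

full : ∀ {X : Set} → Sub X
full = λ _ → true

_⊆_ : ∀ {X : Set} → Sub X → Sub X → Set
S ⊆ C = ∀ x → S x ≡ true → C x ≡ true

diff : ∀ {X : Set} → Sub X → Sub X → Sub X
diff C S x = C x ∧ not (S x)

fil : ∀ {A X : Set} → Sub X → BA A X → List A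
fil S [] = []
fil S ((a , x) ∷ b) = if S x then a ∷ fil S b else fil S b

χ : ∀ {X : Set} → Sub X → Sub X → X → Fin 3
χ C S x = if S x then Fin.suc (Fin.suc Fin.zero)
          else (if C x then Fin.suc Fin.zero else Fin.zero)

! : ∀ {X : Set} → X → ⊤
! = const tt

module _ (Fu : SetFunctor) where
  open SetFunctor Fu

  Zippable : Set₁
  Zippable = ∀ (A' B' : Set) →
    Injective _≡_ _≡_
      (λ (t : F (A' ⊎ B')) → fmap (Sum.map id !) t , fmap (Sum.map ! id) t)

  IsPullback : ∀ {X Y₁ Y₂ P : Set} → (Y₁ → X) → (Y₂ → X) → (P → Y₁) → (P → Y₂) → Set
  IsPullback {X} {Y₁} {Y₂} {P} f g p₁ p₂ =
    (∀ z → f (p₁ z) ≡ g (p₂ z)) ×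
    (∀ (a : Y₁) (b : Y₂) → f a ≡ g b →
      Σ P λ z → (p₁ z ≡ a) × (p₂ z ≡ b) ×
        (∀ z' → p₁ z' ≡ a → p₂ z' ≡ b → z' ≡ z))

  PreservesIntersections : Set₁
  PreservesIntersections = ∀ {X Y₁ Y₂ P : Set}
    (m₁ : Y₁ → X) (m₂ : Y₂ → X) (p₁ : P → Y₁) (p₂ : P → Y₂) →
    Injective _≡_ _≡_ m₁ → Injective _≡_ _≡_ m₂ →
    IsPullback m₁ m₂ p₁ p₂ →
    IsPullback (fmap m₁) (fmap m₂) (fmap p₁) (fmap p₂)

  Flat : Set → Set₁
  Flat A = ∀ {X : Set} → F X → BA A X

  -- ⟨F!, ♭_X⟩ injective for every X (equality on bags is _↭_)
  IsEncoding : (A : Set) → Flat A → Set₁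
  IsEncoding A ♭ = ∀ {X : Set} (t t' : F X) →
    fmap ! t ≡ fmap ! t' → ♭ t ↭ ♭ t' → t ≡ t'

  Subnatural : (A : Set) → Flat A → Set₁
  Subnatural A ♭ = ∀ {X Y : Set} (m : X → Y) → Injective _≡_ _≡_ m →
    ∀ (t : F X) → BAmap m (♭ t) ↭ ♭ (fmap m t)

  record RefinementInterface (A : Set) (♭ : Flat A) : Set₁ where
    field
      W      : Set
      init   : F ⊤ → List A → W
      update : List A → W → W × F (Fin 3) × W
      -- init and update are functions on bags, i.e. respect _↭_
      init-resp   : ∀ (u : F ⊤) {b b' : List A} → b ↭ b' → init u b ≡ init u b'
      update-resp : ∀ {b b' : List A} (w : W) → b ↭ b' → update b w ≡ update b' w
      correct : ∀ (X : Set) → Σ (Sub X → F X → W) λ w →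
        (∀ (S S' : Sub X) → (∀ x → S x ≡ S' x) → ∀ t → w S t ≡ w S' t) ×
        (∀ (t : F X) → init (fmap ! t) (fil full (♭ t)) ≡ w full t) ×
        (∀ (S C : Sub X) → S ⊆ C → ∀ (t : F X) →
          update (fil S (♭ t)) (w C t) ≡ (w S t , fmap (χ C S) t , w (diff C S) t))

-- τ^G_X(t) = { x | t ∉ Gi[G(X \ {x})] }, for a functor G whose
-- equality on G X is given by _≈_.
τ : {G : Set → Set} (gmap : ∀ {X Y : Set} → (X → Y) → G X → G Y)
    (_≈_ : ∀ {X : Set} → G X → G X → Set) {X : Set} → G X → X → Set
τ {G} gmap _≈_ {X} t x =
  ¬ (Σ (G (Σ X (λ y → y ≢ x))) λ u → gmap proj₁ u ≈ t)

τF : (Fu : SetFunctor) {X : Set} → SetFunctor.F Fu X → X → Set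
τF Fu = τ (SetFunctor.fmap Fu) _≡_

τB : (A : Set) {X : Set} → BA A X → X → Set
τB A = τ {BA A} BAmap _↭_

{-# OPTIONS --safe #-}
module Submission where

-- Fix x ∈ X and let tag b : X → X + 2 send x to b and every other point to
-- itself. Both tags are injective and their pullback is X ∖ {x}, so, F
-- preserving intersections, t ∈ F X lies in F(X ∖ {x}) as soon as
-- F(tag true) t = F(tag false) t. By zippability this holds once
-- F χ^X_{x} t = F χ^X_∅ t, and the refinement interface computes F χ^X_S t from
-- fil_S (♭ t) alone. If ♭ t lies in B(A × (X ∖ {x})), then fil_{x} (♭ t) is
-- empty, just like fil_∅ (♭ t). The converse inclusion is subnaturality.

open import Defs
open import Data.Bool using (Bool; true; false; T; not; if_then_else_)
open import Data.Bool.Properties using (T-irrelevant)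
open import Data.Fin using (Fin; zero; suc)
import Data.Fin.Properties as Fin
open import Data.List using ([]; _∷_)
open import Data.List.Properties using (map-∘; map-cong)
open import Data.List.Relation.Binary.Permutation.Propositional
  using (_↭_; ↭-refl; ↭-sym; ↭-trans; ↭-reflexive; prep; swap; module PermutationReasoning)
import Data.List.Relation.Binary.Permutation.Propositional as Perm
open import Data.Nat using (ℕ)
open import Data.Product using (Σ; _×_; _,_; proj₁; proj₂; map₂)
open import Data.Sum using (_⊎_; inj₁; inj₂)
open import Data.Sum.Properties using (inj₁-injective)
import Data.Sum as Sum
open import Data.Unit using (⊤; tt)
open import Function using (_∘_; id; const)
open import Function.Bundles using (_↔_; _⇔_; mk⇔)
open import Function.Definitions using (Injective)
open import Function.Properties.Inverse using (↔⇒↣)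
open import Relation.Binary.Definitions using (DecidableEquality)
open import Relation.Binary.PropositionalEquality
open import Relation.Nullary.Decidable using (yes; no; isYes; via-injection; fromWitnessFalse; toWitnessFalse)
open import Relation.Nullary.Negation using (contraposition)

Outside : {X : Set} → Sub X → Set
Outside {X} S = Σ X λ y → T (not (S y))

Outside-proj₁-injective : {X : Set} {S : Sub X} → Injective _≡_ _≡_ (proj₁ {B = λ y → T (not (S y))})
Outside-proj₁-injective {x = y , p} {.y , p′} refl = cong (y ,_) (T-irrelevant p p′)

fil-resp-↭ : {A X : Set} (S : Sub X) {b b′ : BA A X} → b ↭ b′ → fil S b ↭ fil S b′
fil-resp-↭ S Perm.refl = ↭-refl
fil-resp-↭ S (prep (a , y) p) with S y
... | true  = prep a (fil-resp-↭ S p)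
... | false = fil-resp-↭ S p
fil-resp-↭ S (swap (a , y) (a′ , y′) p) with S y | S y′
... | true  | true  = swap a a′ (fil-resp-↭ S p)
... | true  | false = prep a (fil-resp-↭ S p)
... | false | true  = prep a′ (fil-resp-↭ S p)
... | false | false = fil-resp-↭ S p
fil-resp-↭ S (Perm.trans p q) = ↭-trans (fil-resp-↭ S p) (fil-resp-↭ S q)

fil-const-false : {A X : Set} (b : BA A X) → fil (const false) b ≡ []
fil-const-false []      = refl
fil-const-false (_ ∷ b) = fil-const-false b

fil-BAmap-proj₁-Outside : {A X : Set} (S : Sub X) (u : BA A (Outside S)) →
  fil S (BAmap proj₁ u) ≡ []
fil-BAmap-proj₁-Outside S [] = refl
fil-BAmap-proj₁-Outside S ((a , y , p) ∷ u) with S y | p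
... | false | _ = fil-BAmap-proj₁-Outside S u

BAmap-∘-cong : {A X Y Z : Set} (f : X → Y) (g : Y → Z) (h : X → Z) → (∀ x → g (f x) ≡ h x) →
  (b : BA A X) → BAmap g (BAmap f b) ≡ BAmap h b
BAmap-∘-cong f g h gf≗h b = trans (sym (map-∘ b)) (map-cong (λ (a , x) → cong (a ,_) (gf≗h x)) b)

BAmap-proj₁-image-map : {A X : Set} {P Q : X → Set} → (∀ {y} → P y → Q y) → {b : BA A X} →
  Σ (BA A (Σ X P)) (λ u → BAmap proj₁ u ↭ b) → Σ (BA A (Σ X Q)) (λ u → BAmap proj₁ u ↭ b)
BAmap-proj₁-image-map f (u , e) =
  BAmap (map₂ f) u , ↭-trans (↭-reflexive (BAmap-∘-cong (map₂ f) proj₁ proj₁ (λ _ → refl) u)) e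

module _ (Fu : SetFunctor) where
  open SetFunctor Fu

  fmap-∘-cong : {X Y Z : Set} (f : X → Y) (g : Y → Z) (h : X → Z) → (∀ x → g (f x) ≡ h x) →
    (t : F X) → fmap g (fmap f t) ≡ fmap h t
  fmap-∘-cong f g h gf≗h t = trans (sym (fmap-∘ f g t)) (fmap-cong gf≗h t)

  fmap-proj₁-image-map : {X : Set} {P Q : X → Set} → (∀ {y} → P y → Q y) → {t : F X} →
    Σ (F (Σ X P)) (λ s → fmap proj₁ s ≡ t) → Σ (F (Σ X Q)) (λ s → fmap proj₁ s ≡ t)
  fmap-proj₁-image-map f (s , e) =
    fmap (map₂ f) s , trans (fmap-∘-cong (map₂ f) proj₁ proj₁ (λ _ → refl) s) e

  ♭-image-of-F-image : {A : Set} {♭ : Flat Fu A} → Subnatural Fu A ♭ →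
    {X : Set} (S : Sub X) {t : F X} →
    Σ (F (Outside S)) (λ s → fmap proj₁ s ≡ t) → Σ (BA A (Outside S)) (λ u → BAmap proj₁ u ↭ ♭ t)
  ♭-image-of-F-image {♭ = ♭} subnat S (s , refl) = ♭ s , subnat proj₁ Outside-proj₁-injective s

  fmap-χ-resp-fil : {A : Set} {♭ : Flat Fu A} → RefinementInterface Fu A ♭ →
    {X : Set} {S S′ C : Sub X} → S ⊆ C → S′ ⊆ C → (t : F X) →
    fil S (♭ t) ↭ fil S′ (♭ t) → fmap (χ C S) t ≡ fmap (χ C S′) t
  fmap-χ-resp-fil {♭ = ♭} RI {X} {S} {S′} {C} S⊆C S′⊆C t fil≈ with RefinementInterface.correct RI X
  ... | w , _ , _ , update-correct = cong (proj₁ ∘ proj₂) (begin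
    (w S t , fmap (χ C S) t , w (diff C S) t)    ≡⟨ update-correct S C S⊆C t ⟨
    update (fil S (♭ t)) (w C t)                 ≡⟨ update-resp (w C t) fil≈ ⟩
    update (fil S′ (♭ t)) (w C t)                ≡⟨ update-correct S′ C S′⊆C t ⟩
    (w S′ t , fmap (χ C S′) t , w (diff C S′) t) ∎)
    where
    open RefinementInterface RI
    open ≡-Reasoning

module Puncture {X : Set} (_≟_ : DecidableEquality X) (x : X) where

  ｛x｝ : Sub X
  ｛x｝ y = isYes (y ≟ x)

  tag : Bool → X → X ⊎ Bool
  tag b y = if isYes (y ≟ x) then inj₂ b else inj₁ y

  tag-injective : (b : Bool) → Injective _≡_ _≡_ (tag b)
  tag-injective b {y} {y′} e with y ≟ x | y′ ≟ x
  ... | yes y≡x | yes y′≡x = trans y≡x (sym y′≡x)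
  ... | no _    | no _     = inj₁-injective e
  tag-injective b {y} {y′} () | yes _ | no _
  tag-injective b {y} {y′} () | no _  | yes _

  mark : Bool → Fin 3 → ⊤ ⊎ Bool
  mark b (suc (suc zero)) = inj₂ b
  mark b _                = inj₁ tt

  tag-forget-colour : ∀ b y → Sum.map id ! (tag b y) ≡ (if isYes (y ≟ x) then inj₂ tt else inj₁ y)
  tag-forget-colour b y with y ≟ x
  ... | yes _ = refl
  ... | no _  = refl

  tag-forget-point : ∀ b y → Sum.map ! id (tag b y) ≡ mark b (χ full ｛x｝ y)
  tag-forget-point b y with y ≟ x
  ... | yes _ = refl
  ... | no _  = refl

  module _ (Fu : SetFunctor) where
    open SetFunctor Fu

    tag-pullback :
      IsPullback Fu (tag true) (tag false) (proj₁ {B = λ y → T (not (｛x｝ y))}) proj₁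
    tag-pullback = commutes , universal
      where
      commutes : (z : Outside ｛x｝) → tag true (proj₁ z) ≡ tag false (proj₁ z)
      commutes (y , y∉) with y ≟ x | y∉
      ... | no _ | _ = refl

      universal : ∀ a b → tag true a ≡ tag false b → Σ (Outside ｛x｝) λ z →
        proj₁ z ≡ a × proj₁ z ≡ b × (∀ z′ → proj₁ z′ ≡ a → proj₁ z′ ≡ b → z′ ≡ z)
      universal a b e with a ≟ x | b ≟ x
      universal a .a refl | no a≢x | no _ =
        (a , fromWitnessFalse a≢x) , refl , refl , λ _ z′↦a _ → Outside-proj₁-injective z′↦a
      universal a b () | yes _ | yes _
      universal a b () | yes _ | no _
      universal a b () | no _  | yes _

    fmap-tag-agree : Zippable Fu → (t : F X) →
      fmap (χ full ｛x｝) t ≡ fmap (χ full (const false)) t → fmap (tag true) t ≡ fmap (tag false) t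
    fmap-tag-agree zip t χ≡ =
      zip X Bool (cong₂ _,_ forget-colour (trans (forget-point true) (sym (forget-point false))))
      where
      forget-colour :
        fmap (Sum.map id !) (fmap (tag true) t) ≡ fmap (Sum.map id !) (fmap (tag false) t)
      forget-colour = trans (fmap-∘-cong Fu (tag true) _ _ (tag-forget-colour true) t)
                            (sym (fmap-∘-cong Fu (tag false) _ _ (tag-forget-colour false) t))

      forget-point : ∀ b → fmap (Sum.map ! id) (fmap (tag b) t) ≡ fmap (const (inj₁ tt)) t
      forget-point b = begin
        fmap (Sum.map ! id) (fmap (tag b) t)           ≡⟨ fmap-∘-cong Fu (tag b) _ _ (tag-forget-point b) t ⟩
        fmap (mark b ∘ χ full ｛x｝) t                   ≡⟨ fmap-∘ (χ full ｛x｝) (mark b) t ⟩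
        fmap (mark b) (fmap (χ full ｛x｝) t)            ≡⟨ cong (fmap (mark b)) χ≡ ⟩
        fmap (mark b) (fmap (χ full (const false)) t) ≡⟨ fmap-∘-cong Fu _ _ _ (λ _ → refl) t ⟩
        fmap (const (inj₁ tt)) t                       ∎
        where open ≡-Reasoning

    F-image-of-♭-image : {A : Set} {♭ : Flat Fu A} →
      Zippable Fu → PreservesIntersections Fu → RefinementInterface Fu A ♭ → {t : F X} →
      Σ (BA A (Outside ｛x｝)) (λ u → BAmap proj₁ u ↭ ♭ t) → Σ (F (Outside ｛x｝)) (λ s → fmap proj₁ s ≡ t)
    F-image-of-♭-image {♭ = ♭} zip pint RI {t} (u , u↦♭t)
      with proj₂ F-tag-pullback t t (fmap-tag-agree zip t χ≡)
      where
      F-tag-pullback : IsPullback Fu (fmap (tag true)) (fmap (tag false)) (fmap proj₁) (fmap proj₁)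
      F-tag-pullback = pint _ _ _ _ (tag-injective true) (tag-injective false) tag-pullback

      fil≈ : fil ｛x｝ (♭ t) ↭ fil (const false) (♭ t)
      fil≈ = begin
        fil ｛x｝ (♭ t)             ↭⟨ fil-resp-↭ ｛x｝ (↭-sym u↦♭t) ⟩
        fil ｛x｝ (BAmap proj₁ u)   ≡⟨ fil-BAmap-proj₁-Outside ｛x｝ u ⟩
        []                         ≡⟨ fil-const-false (♭ t) ⟨
        fil (const false) (♭ t)    ∎
        where open PermutationReasoning

      χ≡ : fmap (χ full ｛x｝) t ≡ fmap (χ full (const false)) t
      χ≡ = fmap-χ-resp-fil Fu RI (λ _ _ → refl) (λ _ _ → refl) t fil≈
    ... | s , s↦t , _ = s , s↦t

    τF⇔τB : {A : Set} {♭ : Flat Fu A} → Zippable Fu → PreservesIntersections Fu →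
      Subnatural Fu A ♭ → RefinementInterface Fu A ♭ → (t : F X) → τF Fu t x ⇔ τB A (♭ t) x
    τF⇔τB zip pint subnat RI t = mk⇔
      (contraposition (fmap-proj₁-image-map Fu toWitnessFalse
                       ∘ F-image-of-♭-image zip pint RI
                       ∘ BAmap-proj₁-image-map fromWitnessFalse))
      (contraposition (BAmap-proj₁-image-map toWitnessFalse
                       ∘ ♭-image-of-F-image Fu subnat ｛x｝
                       ∘ fmap-proj₁-image-map Fu fromWitnessFalse))

theorem40 : (Fu : SetFunctor) (A : Set) (♭ : Flat Fu A) →
    Zippable Fu → PreservesIntersections Fu →
    IsEncoding Fu A ♭ → Subnatural Fu A ♭ →
    RefinementInterface Fu A ♭ →
    (X : Set) (n : ℕ) → X ↔ Fin n →
    (∀ (t : SetFunctor.F Fu X) (x : X) → τF Fu t x ⇔ τB A (♭ t) x) ×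
    (∀ (c : X → SetFunctor.F Fu X) (x y : X) → τF Fu (c x) y ⇔ τB A (♭ (c x)) y)
theorem40 Fu A ♭ zip pint _ subnat RI X _ X↔Fin = τ-agree , λ c x → τ-agree (c x)
  where
  τ-agree : ∀ t x → τF Fu t x ⇔ τB A (♭ t) x
  τ-agree t x = Puncture.τF⇔τB (via-injection (↔⇒↣ X↔Fin) Fin._≟_) x Fu zip pint subnat RI t
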